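{- Let $\mathfrak{A}=\langle W,R,V\rangle$ be an $R$-connected Kripke structure whose frame $\langle W,R\rangle$ is Euclidean. Then every world $w\in Q_{\mathfrak{A}}$ is reflexive (i.e. $\langle w,w\rangle\in R$), and $Q_{\mathfrak{A}}$ is an $R$-clique.
   Context: A Kripke structure is $\mathfrak{A}=\langle W,R,V\rangle$ with $R\subseteq W\times W$ and a valuation $V$ of propositional variables; it is Euclidean if for all $x,y,z$: $\langle x,y\rangle\in R$ and $\langle x,z\rangle\in R$ imply $\langle y,z\rangle\in R$. It is $R$-connected if the graph $\langle W, R\cup R^{ -1}\rangle$ is connected. A world $w$ is a lantern if there is no $w'\in W$ with $\langle w',w\rangle\in R$; $L_{\mathfrak{A}}$ denotes the set of lanterns and $Q_{\mathfrak{A}}:=W\setminus L_{\mathfrak{A}}$ the set of inner worlds. Two worlds $w_1,w_2$ are $R$-equivalent if $\langle w_1,w_2\rangle\in R$ and $\langle w_2,w_1\rangle\in R$. The $R$-clique of a world $w$, $Q_{\mathfrak{A}}(w)$, is the set consisting of $w$ together with all worlds $R$-equivalent to $w$. A set $Q\subseteq W$ is an $R$-clique in $\mathfrak{A}$ if $Q=Q_{\mathfrak{A}}(w)$ for some $w\in Q$. -}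

module Defs where

open import Level using (Level; _⊔_; suc)
open import Data.Product using (Σ; ∃; _×_; _,_)
open import Data.Sum using (_⊎_)
open import Relation.Binary.Construct.Closure.ReflexiveTransitive using (Star)

record Kripke (a r : Level) (Var : Set) : Set (Level.suc (a ⊔ r)) where
  field
    W : Set a
    R : W → W → Set r
    V : Var → W → Set a

module _ {a r : Level} {Var : Set} (𝔄 : Kripke a r Var) where
  open Kripke 𝔄

  Euclidean : Set (a ⊔ r)
  Euclidean = ∀ {x y z} → R x y → R x z → R y z

  Sym : W → W → Set r
  Sym x y = R x y ⊎ R y x

  RConnected : Set (a ⊔ r)
  RConnected = ∀ x y → Star Sym x y

  -- inner worlds Q_𝔄 = W ∖ L_𝔄 (w has an R-predecessor)
  Inner : W → Set (a ⊔ r)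
  Inner w = ∃ λ w' → R w' w

  Lantern : W → Set (a ⊔ r)
  Lantern w = Inner w → Data.Empty.⊥
    where import Data.Empty

  REquiv : W → W → Set r
  REquiv w₁ w₂ = R w₁ w₂ × R w₂ w₁

  CliqueOf : W → W → Set (a ⊔ r)
  CliqueOf w v = (v ≡ w) ⊎ Lift a (REquiv w v)
    where open import Relation.Binary.PropositionalEquality using (_≡_)
          open import Level using (Lift)

  IsRClique : (W → Set (a ⊔ r)) → Set (a ⊔ r)
  IsRClique Q = Σ W λ w → Q w × (∀ v → (Q v → CliqueOf w v) × (CliqueOf w v → Q v))

-- In a Euclidean frame every successor of a world is reflexive, so inner worlds
-- are reflexive. Fix a reflexive world w. Sharing an R-successor with w is a
-- property that survives a step along R and, via the Euclidean law, a step
-- against R; by connectedness every world therefore shares a successor with w.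
-- Two reflexive worlds sharing a successor u both see u and are seen by it,
-- so they see each other: any two inner worlds are R-equivalent.
module Submission where

open import Defs
open import Level using (Level; _⊔_; lift)
open import Data.Product using (_×_; _,_; ∃)
open import Data.Sum using (inj₁; inj₂)
open import Relation.Binary.Construct.Closure.ReflexiveTransitive using (Star; ε; _◅_)
open import Relation.Binary.PropositionalEquality using (refl)

module EuclideanFrame {a r : Level} {Var : Set} (𝔄 : Kripke a r Var) (euclidean : Euclidean 𝔄) where
  open Kripke 𝔄

  successor-reflexive : ∀ {x y} → R x y → R y y
  successor-reflexive xy = euclidean xy xy

  inner⇒reflexive : ∀ {w} → Inner 𝔄 w → R w w
  inner⇒reflexive (_ , uw) = successor-reflexive uw

  CommonSuccessor : W → W → Set (a ⊔ r)
  CommonSuccessor x y = ∃ λ u → R x u × R y u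

  commonSuccessor-reflexive⇒R : ∀ {w x} → R w w → R x x → CommonSuccessor w x → R w x
  commonSuccessor-reflexive⇒R ww xx (u , wu , xu) = euclidean (euclidean wu ww) (euclidean xu xx)

  commonSuccessor-forward : ∀ {w x y} → CommonSuccessor w x → R x y → CommonSuccessor w y
  commonSuccessor-forward (u , wu , xu) xy = u , wu , euclidean xy xu

  commonSuccessor-backward : ∀ {w x y} → R w w → CommonSuccessor w x → R y x → CommonSuccessor w y
  commonSuccessor-backward ww common yx =
    _ , commonSuccessor-reflexive⇒R ww (successor-reflexive yx) common , yx

  commonSuccessor-along : ∀ {w x y} → R w w → CommonSuccessor w x → Star (Sym 𝔄) x y → CommonSuccessor w y
  commonSuccessor-along ww common ε              = common
  commonSuccessor-along ww common (inj₁ xz ◅ zy) = commonSuccessor-along ww (commonSuccessor-forward common xz) zy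
  commonSuccessor-along ww common (inj₂ zx ◅ zy) = commonSuccessor-along ww (commonSuccessor-backward ww common zx) zy

  module _ (connected : RConnected 𝔄) where

    inner⇒R : ∀ {w v} → Inner 𝔄 w → Inner 𝔄 v → R w v
    inner⇒R {w} {v} iw iv = commonSuccessor-reflexive⇒R ww (inner⇒reflexive iv)
      (commonSuccessor-along ww (w , ww , ww) (connected w v))
      where ww = inner⇒reflexive iw

    inner⇒REquiv : ∀ {w v} → Inner 𝔄 w → Inner 𝔄 v → REquiv 𝔄 w v
    inner⇒REquiv iw iv = inner⇒R iw iv , inner⇒R iv iw

    inner-isRClique : ∀ {w} → Inner 𝔄 w → IsRClique 𝔄 (Inner 𝔄)
    inner-isRClique {w} iw = w , iw , λ v → inner⇒cliqueOf , cliqueOf⇒inner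
      where
      inner⇒cliqueOf : ∀ {v} → Inner 𝔄 v → CliqueOf 𝔄 w v
      inner⇒cliqueOf iv = inj₂ (lift (inner⇒REquiv iw iv))

      cliqueOf⇒inner : ∀ {v} → CliqueOf 𝔄 w v → Inner 𝔄 v
      cliqueOf⇒inner (inj₁ refl)             = iw
      cliqueOf⇒inner (inj₂ (lift (wv , _))) = w , wv

mainTheorem9 : {a r : Level} {Var : Set} (𝔄 : Kripke a r Var) →
    RConnected 𝔄 → Euclidean 𝔄 →
    (∀ w → Inner 𝔄 w → Kripke.R 𝔄 w w) × (∀ w → Inner 𝔄 w → IsRClique 𝔄 (Inner 𝔄))
mainTheorem9 𝔄 connected euclidean =
  (λ _ → inner⇒reflexive) , (λ _ → inner-isRClique connected)
  where open EuclideanFrame 𝔄 euclidean
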